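{- Consider the EMOMA data structure described in the context, after an arbitrary sequence of insertion and removal operations performed by the EMOMA procedures. If every element currently in the set has either been placed successfully in the external cuckoo hash table or lies in the stash, then every search operation on the EMOMA structure is completed with one external memory access: for any key $x$, the search procedure reads at most one bucket of the external table, and it returns the value associated with $x$ whenever $x$ is stored in the structure.
   Context: EMOMA ("Exact Match in One Memory Access") is a dictionary storing key–value pairs $(x,v_x)$ (the key $x$ is called an element). It consists of three parts. (1) A cuckoo hash table in external (off-chip) memory: a single array of buckets, each holding up to 4 elements, with two hash functions $h_1,h_2$; each stored element $x$ resides in bucket $h_1(x)$ or bucket $h_2(x)$. Reading one bucket is one external memory access. (2) A counting block Bloom filter (CBBF): an array of blocks of bits (with associated counters), using $h_1$ as its block selection function and $k$ bit-selection hash functions $g_1,\dots,g_k$ within a block. Inserting $y$ into the CBBF increments the counters at positions $g_1(y),\dots,g_k(y)$ in block $h_1(y)$ (setting the corresponding bits to 1); removing $y$ decrements them, clearing a bit when its counter reaches $0$. An element $z$ is "positive" on the CBBF if all bits $g_1(z),\dots,g_k(z)$ of block $h_1(z)$ are 1, and "negative" otherwise. The CBBF contains exactly the elements currently stored in the table at their second bucket $h_2$. (3) A small stash holding elements pending insertion or that failed insertion. Search for $x$: if $x$ is in the stash, return its value; otherwise query the CBBF; on a negative response read bucket $h_1(x)$, on a positive response read bucket $h_2(x)$; return $v_x$ if $x$ is found in the read bucket and a null value otherwise. Insertion of $x$: $x$ is first placed in the stash; then repeatedly (up to a maximum number $t$ of iterations) an element $x$ from the stash is placed in the table as follows. Its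 bucket is chosen by cases: if $x$ is positive on the CBBF, bucket $h_2(x)$; else if bucket $h_1(x)$ has an empty cell, bucket $h_1(x)$; else if bucket $h_2(x)$ has an empty cell and inserting $x$ into the CBBF would make no element stored in bucket $h_1(x)$ via its first hash function become positive, bucket $h_2(x)$; else if inserting $x$ into the CBBF would create such a new positive, bucket $h_1(x)$; else (both buckets full, no new positives) a random one of the two. A cell in the chosen bucket is taken (an empty one if available, otherwise an occupied one whose element is not "locked", i.e. not an element stored at $h_2$ that is positive on the CBBF). Any element $y$ displaced from that cell is moved to the stash and, if it was stored at $h_2(y)$, removed from the CBBF. If $x$ is placed at $h_2(x)$, then $x$ is inserted into the CBBF, and any elements in bucket $h_1(x)$ stored there via their first hash function that become positive on the CBBF are moved to the stash. Elements not placed after $t$ iterations remain in the stash. Removal of $x$: search for $x$ and delete it; if it was stored at $h_2(x)$, also remove it from the CBBF. -}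

module Defs where

open import Data.Nat using (ℕ; zero; suc; _∸_)
open import Data.Fin using (Fin) renaming (zero to fzero; suc to fsuc)
open import Data.Fin.Properties using () renaming (_≟_ to _≟F_)
open import Data.Bool using (Bool; true; false; not; _∧_; if_then_else_)
open import Data.Maybe using (Maybe; just; nothing)
open import Data.Product using (_×_; _,_; proj₁; Σ)
open import Data.Sum using (_⊎_)
open import Data.List using (List; []; _∷_; _++_; filterᵇ; allFin; foldr)
import Data.List as L
open import Data.Bool.ListAction using (all; any)
open import Data.Vec using (Vec; lookup; _[_]≔_; replicate; toList)
import Data.Vec as Vec
open import Data.List.Membership.Propositional using (_∈_)
open import Relation.Binary.Definitions using (DecidableEquality)
open import Relation.Binary.PropositionalEquality using (_≡_)
open import Relation.Nullary using (¬_; does)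

-- Which hash function an element stored in the table was placed with.
data Hash : Set where
  first second : Hash

-- The EMOMA structure, parameterised by
--   K, V          : keys (elements) and values, keys with decidable equality
--   m             : number of buckets of the cuckoo table (= number of CBBF blocks,
--                   since the CBBF uses h₁ as its block-selection function)
--   b             : number of bits (counters) per CBBF block
--   k             : number of bit-selection hash functions g₁ … g_k
--   t             : maximum number of placement iterations per insertion
--   h₁ h₂         : the two cuckoo hash functions
--   g             : the bit-selection hash functions within a block
-- Buckets hold 4 cells each.
module EMOMA {K V : Set} (_≟_ : DecidableEquality K)
  (m b k t : ℕ) (h₁ h₂ : K → Fin m) (g : Fin k → K → Fin b) where

  record Entry : Set where
    constructor entry
    field
      key : K
      val : V
      via : Hash
  open Entry public

  Cell : Set
  Cell = Maybe Entry

  Bucket : Set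
  Bucket = Vec Cell 4

  Table : Set
  Table = Fin m → Bucket

  -- counters of the counting block Bloom filter: block, position within block
  Counters : Set
  Counters = Fin m → Fin b → ℕ

  Item : Set
  Item = K × V

  record State : Set where
    field
      table : Table
      cbbf  : Counters
      stash : List Item
  open State public

  initial : State
  initial = record { table = λ _ → replicate 4 nothing ; cbbf = λ _ _ → 0 ; stash = [] }

  hashOf : Hash → K → Fin m
  hashOf first  = h₁
  hashOf second = h₂

  isZero : ℕ → Bool
  isZero zero    = true
  isZero (suc _) = false

  bit : Counters → Fin m → Fin b → Bool
  bit C i j = not (isZero (C i j))

  positive : Counters → K → Bool
  positive C z = all (λ i → bit C (h₁ z) (g i z)) (allFin k)

  bump : (ℕ → ℕ) → Fin m → Fin b → Counters → Counters
  bump f i j C i' j' = if does (i' ≟F i) ∧ does (j' ≟F j) then f (C i' j') else C i' j'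

  cbbfInsert : K → Counters → Counters
  cbbfInsert y C = foldr (λ i C' → bump suc (h₁ y) (g i y) C') C (allFin k)

  cbbfRemove : K → Counters → Counters
  cbbfRemove y C = foldr (λ i C' → bump (λ n → n ∸ 1) (h₁ y) (g i y) C') C (allFin k)

  setBucket : Fin m → Bucket → Table → Table
  setBucket i B T i' = if does (i' ≟F i) then B else T i'

  isEmptyCell : Cell → Bool
  isEmptyCell nothing  = true
  isEmptyCell (just _) = false

  hasEmpty : Bucket → Bool
  hasEmpty B = any isEmptyCell (toList B)

  findIn : ∀ {n} → K → Vec Cell n → Maybe V
  findIn x Vec.[] = nothing
  findIn x (nothing Vec.∷ cs) = findIn x cs
  findIn x (just e Vec.∷ cs) = if does (key e ≟ x) then just (val e) else findIn x cs

  findCell : ∀ {n} → K → Vec Cell n → Maybe (Fin n × Entry)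
  findCell x Vec.[] = nothing
  findCell x (nothing Vec.∷ cs) with findCell x cs
  ... | just (j , e) = just (fsuc j , e)
  ... | nothing = nothing
  findCell x (just e Vec.∷ cs) with does (key e ≟ x) | findCell x cs
  ... | true  | _ = just (fzero , e)
  ... | false | just (j , e') = just (fsuc j , e')
  ... | false | nothing = nothing

  findStash : K → List Item → Maybe V
  findStash x [] = nothing
  findStash x ((y , v) ∷ rest) = if does (y ≟ x) then just v else findStash x rest

  cellItems : List Cell → List Item
  cellItems [] = []
  cellItems (nothing ∷ cs) = cellItems cs
  cellItems (just e ∷ cs) = (key e , val e) ∷ cellItems cs

  -- Search: returns the result and the number of external memory
  -- accesses (bucket reads) performed.

  searchBucket : State → K → Fin m
  searchBucket s x = if positive (cbbf s) x then h₂ x else h₁ x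

  search : State → K → Maybe V × ℕ
  search s x with findStash x (stash s)
  ... | just v  = just v , 0
  ... | nothing = findIn x (table s (searchBucket s x)) , 1

  Stored : State → K → V → Set
  Stored s x v = ((x , v) ∈ stash s)
    ⊎ Σ (Fin m) (λ i → Σ (Fin 4) (λ j → Σ Hash (λ h → lookup (table s i) j ≡ just (entry x v h))))

  Present : State → K → Set
  Present s x = Σ V (Stored s x)

  becomesPos : Counters → Counters → Cell → Bool
  becomesPos C C' nothing = false
  becomesPos C C' (just (entry z _ first))  = not (positive C z) ∧ positive C' z
  becomesPos C C' (just (entry z _ second)) = false

  createsNewPos : State → K → Bool
  createsNewPos s y =
    any (becomesPos (cbbf s) (cbbfInsert y (cbbf s))) (toList (table s (h₁ y)))

  data ChooseHash (s : State) (y : K) : Hash → Set where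
    isPositive : positive (cbbf s) y ≡ true → ChooseHash s y second
    free₁      : positive (cbbf s) y ≡ false → hasEmpty (table s (h₁ y)) ≡ true
               → ChooseHash s y first
    free₂      : positive (cbbf s) y ≡ false → hasEmpty (table s (h₁ y)) ≡ false
               → hasEmpty (table s (h₂ y)) ≡ true → createsNewPos s y ≡ false
               → ChooseHash s y second
    avoid      : positive (cbbf s) y ≡ false → hasEmpty (table s (h₁ y)) ≡ false
               → createsNewPos s y ≡ true
               → ChooseHash s y first
    random     : positive (cbbf s) y ≡ false → hasEmpty (table s (h₁ y)) ≡ false
               → hasEmpty (table s (h₂ y)) ≡ false → createsNewPos s y ≡ false
               → (c : Hash) → ChooseHash s y c

  locked : Counters → Entry → Bool
  locked C (entry z _ first)  = false
  locked C (entry z _ second) = positive C z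

  data ValidCell (C : Counters) (B : Bucket) (j : Fin 4) : Set where
    emptyCell : lookup B j ≡ nothing → ValidCell C B j
    unlocked  : hasEmpty B ≡ false → (e : Entry) → lookup B j ≡ just e
              → locked C e ≡ false → ValidCell C B j

  displacedItems : Cell → List Item
  displacedItems nothing  = []
  displacedItems (just e) = (key e , val e) ∷ []

  removeDisplaced : Cell → Counters → Counters
  removeDisplaced nothing C = C
  removeDisplaced (just (entry z _ first)) C  = C
  removeDisplaced (just (entry z _ second)) C = cbbfRemove z C

  finishSecond : K → Table → Counters → List Item → State
  finishSecond y T C st =
    record { table = setBucket (h₁ y) B' T
           ; cbbf  = C'
           ; stash = cellItems (L.filterᵇ (becomesPos C C') (toList B)) ++ st }
    where
      C' = cbbfInsert y C
      B  = T (h₁ y)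
      B' = Vec.map (λ cell → if becomesPos C C' cell then nothing else cell) B

  -- place y (value w, already removed from the stash, remaining stash `rest`)
  -- using hash c, in cell j of bucket hashOf c y
  place : State → List Item → K → V → Hash → Fin 4 → State
  place s rest y w c j = finish c
    where
      i   = hashOf c y
      B   = table s i
      old = lookup B j
      st₁ = displacedItems old ++ rest
      C₁  = removeDisplaced old (cbbf s)
      T₁  = setBucket i (B [ j ]≔ just (entry y w c)) (table s)
      finish : Hash → State
      finish first  = record { table = T₁ ; cbbf = C₁ ; stash = st₁ }
      finish second = finishSecond y T₁ C₁ st₁

  data Step (s : State) : State → Set where
    step : (pre post : List Item) (y : K) (w : V)
         → stash s ≡ pre ++ (y , w) ∷ post
         → (c : Hash) → ChooseHash s y c
         → (j : Fin 4) → ValidCell (cbbf s) (table s (hashOf c y)) j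
         → Step s (place s (pre ++ post) y w c j)

  data StepsUpTo : ℕ → State → State → Set where
    stop : ∀ {n s} → StepsUpTo n s s
    next : ∀ {n s s₁ s₂} → Step s s₁ → StepsUpTo n s₁ s₂ → StepsUpTo (suc n) s s₂

  deleteAt : K → Fin m → State → State
  deleteAt x i s with findCell x (table s i)
  ... | nothing = s
  ... | just (j , e) = record s
        { table = setBucket i (table s i [ j ]≔ nothing) (table s)
        ; cbbf  = removeDisplaced (just e) (cbbf s) }

  remove : K → State → State
  remove x s with findStash x (stash s)
  ... | just _  = record s { stash = filterᵇ (λ p → not (does (proj₁ p ≟ x))) (stash s) }
  ... | nothing = deleteAt x (searchBucket s x) s

  -- Operations and reachable states.  The second index is the abstract
  -- set (dictionary) of key–value pairs that should currently be stored.

  data Op : State → List Item → State → List Item → Set where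
    ins : ∀ {s D s'} (x : K) (v : V) → ¬ Present s x
        → StepsUpTo t (record s { stash = (x , v) ∷ stash s }) s'
        → Op s D s' ((x , v) ∷ D)
    del : ∀ {s D} (x : K)
        → Op s D (remove x s) (filterᵇ (λ p → not (does (proj₁ p ≟ x))) D)

  data Reachable : State → List Item → Set where
    init : Reachable initial []
    op   : ∀ {s D s' D'} → Reachable s D → Op s D s' D' → Reachable s' D'

module Submission where

open import Defs
open import Data.Nat using (ℕ; _≤_)
open import Data.Fin using (Fin)
open import Data.List using (List)
open import Data.Maybe using (just)
open import Data.Product using (_×_; _,_; proj₁; proj₂)
open import Data.List.Membership.Propositional using (_∈_)
open import Relation.Binary.Definitions using (DecidableEquality)
open import Relation.Binary.PropositionalEquality using (_≡_)

open import Data.Nat using (suc; _+_; _∸_; z≤n; s≤s)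
open import Data.Nat.Properties
open import Data.Nat.Tactic.RingSolver using (solve-∀)
open import Data.Fin using (punchIn) renaming (zero to fzero; suc to fsuc)
open import Data.Fin.Properties using (punchInᵢ≢i) renaming (_≟_ to _≟F_)
open import Data.Bool using (Bool; true; false; not; _∧_; if_then_else_)
open import Data.Bool.ListAction using (all)
open import Data.Maybe using (nothing)
open import Data.Sum using (inj₁; inj₂)
open import Data.Unit using (⊤; tt)
open import Data.Empty using (⊥; ⊥-elim)
open import Data.List using ([]; _∷_; _++_; allFin; filterᵇ; foldr)
open import Data.List.Relation.Unary.Any using (here; there)
open import Data.List.Membership.Propositional.Properties using (∈-allFin)
open import Data.Vec using (Vec; lookup; _[_]≔_; toList) renaming (_∷_ to _∷ᵥ_)
import Data.Vec as Vec
open import Data.Vec.Properties using (lookup∘update; lookup∘update′; lookup-map; lookup-replicate)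
open import Data.Vec.Functional using (removeAt)
open import Relation.Nullary using (¬_; Dec; yes; no; does)
open import Relation.Binary.PropositionalEquality
  using (refl; sym; trans; cong; cong₂; subst; _≢_; module ≡-Reasoning)
open import Algebra.Properties.CommutativeMonoid.Sum +-0-commutativeMonoid
  using (sum; sum-remove; sum-cong-≗; sum-replicate-zero)

-- Every state reachable by the EMOMA operations satisfies an
-- invariant with four parts:
--   * placed:   an element stored in bucket i via hash function h has hash h equal to i;
--   * negative: every element stored via h₁ is negative on the CBBF;
--   * exact:    every CBBF counter equals the number of (element, bit-selection
--               function) pairs of elements stored via h₂ that hit it;
--   * unique:   every key occurs at most once in the stash and table together.
-- Exactness makes every element stored via h₂ positive, so with "placed" and
-- "negative" the bucket read by a search is the one holding the element, and
-- uniqueness makes both the stash lookup and the bucket scan return its value.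

if-yes : ∀ {p} {P : Set p} {A : Set} (d : Dec P) {x y : A} → P → (if does d then x else y) ≡ x
if-yes (yes _) _ = refl
if-yes (no ¬p) p = ⊥-elim (¬p p)

if-no : ∀ {p} {P : Set p} {A : Set} (d : Dec P) {x y : A} → ¬ P → (if does d then x else y) ≡ y
if-no (yes p) ¬p = ⊥-elim (¬p p)
if-no (no _) _ = refl

not-twice : ∀ {a b} → 1 ≤ a → 1 ≤ b → a + b ≤ 1 → ⊥
not-twice 1≤a 1≤b a+b≤1 with ≤-trans (+-mono-≤ 1≤a 1≤b) a+b≤1
... | s≤s ()

exchange-∸ : ∀ {a b o n} → a + o ≡ b + n → o ≤ b → a ≡ n + (b ∸ o)
exchange-∸ {a} {b} {o} {n} eq o≤b = begin
  a            ≡⟨ m+n∸n≡m a o ⟨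
  a + o ∸ o    ≡⟨ cong (_∸ o) eq ⟩
  b + n ∸ o    ≡⟨ cong (_∸ o) (+-comm b n) ⟩
  n + b ∸ o    ≡⟨ +-∸-assoc n o≤b ⟩
  n + (b ∸ o)  ∎
  where open ≡-Reasoning

exchange-trans : ∀ {a u w v o n} → a + u ≡ w + v → v + o ≡ u + n → a + o ≡ w + n
exchange-trans {a} {u} {w} {v} {o} {n} e₁ e₂ = +-cancelʳ-≡ u (a + o) (w + n) (begin
  a + o + u    ≡⟨ swap a o u ⟩
  a + u + o    ≡⟨ cong (_+ o) e₁ ⟩
  w + v + o    ≡⟨ +-assoc w v o ⟩
  w + (v + o)  ≡⟨ cong (w +_) e₂ ⟩
  w + (u + n)  ≡⟨ shift w u n ⟩
  w + n + u    ∎)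
  where
  open ≡-Reasoning
  swap : ∀ x y z → x + y + z ≡ x + z + y
  swap = solve-∀
  shift : ∀ x y z → x + (y + z) ≡ x + z + y
  shift = solve-∀

sum-update : ∀ {n} (f g : Fin n → ℕ) (i : Fin n) → (∀ j → j ≢ i → f j ≡ g j)
           → sum g + f i ≡ sum f + g i
sum-update {suc n} f g i agree = begin
  sum g + f i                     ≡⟨ cong (_+ f i) (sum-remove {i = i} g) ⟩
  g i + sum (removeAt g i) + f i  ≡⟨ cong (λ r → g i + r + f i) sameRest ⟩
  g i + sum (removeAt f i) + f i  ≡⟨ exchange (g i) _ (f i) ⟩
  f i + sum (removeAt f i) + g i  ≡⟨ cong (_+ g i) (sum-remove {i = i} f) ⟨
  sum f + g i                     ∎
  where
  open ≡-Reasoning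
  exchange : ∀ x r y → x + r + y ≡ y + r + x
  exchange = solve-∀
  sameRest : sum (removeAt g i) ≡ sum (removeAt f i)
  sameRest = sum-cong-≗ (λ j → sym (agree (punchIn i j) (punchInᵢ≢i i j)))

term≤sum : ∀ {n} (f : Fin n → ℕ) i → f i ≤ sum f
term≤sum {suc n} f i = ≤-trans (m≤m+n (f i) _) (≤-reflexive (sym (sum-remove {i = i} f)))

sum-zero : ∀ {n} (f : Fin n → ℕ) → (∀ i → f i ≡ 0) → sum f ≡ 0
sum-zero {n} f f≡0 = trans (sum-cong-≗ f≡0) (sum-replicate-zero n)

vecWeight : ∀ {A : Set} {n} → (A → ℕ) → Vec A n → ℕ
vecWeight w B = sum (λ j → w (lookup B j))

vecWeight-update : ∀ {A : Set} {n} (w : A → ℕ) (B : Vec A n) j x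
                 → vecWeight w (B [ j ]≔ x) + w (lookup B j) ≡ vecWeight w B + w x
vecWeight-update w B j x =
  trans (sum-update (λ j' → w (lookup B j')) (λ j' → w (lookup (B [ j ]≔ x) j')) j agree)
        (cong (λ y → vecWeight w B + w y) (lookup∘update j B x))
  where
  agree : ∀ j' → j' ≢ j → w (lookup B j') ≡ w (lookup (B [ j ]≔ x) j')
  agree j' j'≢j = cong w (sym (lookup∘update′ j'≢j B x))

all-true : ∀ {A : Set} (p : A → Bool) xs → (∀ x → p x ≡ true) → all p xs ≡ true
all-true p [] _ = refl
all-true p (x ∷ xs) always rewrite always x = all-true p xs always

all-mono : ∀ {A : Set} {p q : A → Bool} xs → (∀ x → p x ≡ true → q x ≡ true)
         → all p xs ≡ true → all q xs ≡ true
all-mono [] _ _ = refl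
all-mono {p = p} (x ∷ xs) p⇒q holds with p x in px | holds
... | true  | rest rewrite p⇒q x px = all-mono xs p⇒q rest
... | false | ()

all-cong : ∀ {A : Set} {p q : A → Bool} xs → (∀ x → p x ≡ q x) → all p xs ≡ all q xs
all-cong [] _ = refl
all-cong (x ∷ xs) same = cong₂ _∧_ (same x) (all-cong xs same)

module Correctness {K V : Set} (_≟_ : DecidableEquality K) (m b k t : ℕ)
  (h₁ h₂ : K → Fin m) (g : Fin k → K → Fin b) where
  open EMOMA {K} {V} _≟_ m b k t h₁ h₂ g

  setCell : Fin m → Fin 4 → Cell → Table → Table
  setCell i j cell T = setBucket i (T i [ j ]≔ cell) T

  setBucket-same : ∀ i B (T : Table) → setBucket i B T i ≡ B
  setBucket-same i B T = if-yes (i ≟F i) refl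

  setBucket-other : ∀ {i i'} B (T : Table) → i' ≢ i → setBucket i B T i' ≡ T i'
  setBucket-other {i} {i'} B T i'≢i = if-no (i' ≟F i) i'≢i

  AllCells : (Fin m → Cell → Set) → Table → Set
  AllCells P T = ∀ i j → P i (lookup (T i) j)

  AllCells-setCell : ∀ {P : Fin m → Cell → Set} {T} i j cell
                   → AllCells P T → P i cell → AllCells P (setCell i j cell T)
  AllCells-setCell {P} {T} i j cell every new i' j' with i' ≟F i
  ... | no _ = every i' j'
  ... | yes refl with j' ≟F j
  ...   | yes refl = subst (P i) (sym (lookup∘update j (T i) cell)) new
  ...   | no j'≢j = subst (P i) (sym (lookup∘update′ j'≢j (T i) cell)) (every i j')

  evict : ∀ {n} → (Cell → Bool) → Vec Cell n → Vec Cell n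
  evict p B = Vec.map (λ cell → if p cell then nothing else cell) B

  AllCells-evict : ∀ {P : Fin m → Cell → Set} {T} i₀ p
                 → AllCells P T → (∀ i → P i nothing) → AllCells P (setBucket i₀ (evict p (T i₀)) T)
  AllCells-evict {P} {T} i₀ p every empty i j with i ≟F i₀
  ... | no _ = every i j
  ... | yes refl rewrite lookup-map j (λ cell → if p cell then nothing else cell) (T i)
    with p (lookup (T i) j)
  ...   | true = empty i
  ...   | false = every i j

  tableWeight : (Cell → ℕ) → Table → ℕ
  tableWeight w T = sum (λ i → vecWeight w (T i))

  tableWeight-setBucket : ∀ w i B T
    → tableWeight w (setBucket i B T) + vecWeight w (T i) ≡ tableWeight w T + vecWeight w B
  tableWeight-setBucket w i B T =
    trans (sum-update (λ i' → vecWeight w (T i')) (λ i' → vecWeight w (setBucket i B T i')) i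
                      (λ i' i'≢i → cong (vecWeight w) (sym (setBucket-other B T i'≢i))))
          (cong (λ B' → tableWeight w T + vecWeight w B') (setBucket-same i B T))

  tableWeight-setCell : ∀ w i j cell T
    → tableWeight w (setCell i j cell T) + w (lookup (T i) j) ≡ tableWeight w T + w cell
  tableWeight-setCell w i j cell T =
    exchange-trans {u = vecWeight w (T i)} {v = vecWeight w (T i [ j ]≔ cell)}
      (tableWeight-setBucket w i (T i [ j ]≔ cell) T) (vecWeight-update w (T i) j cell)

  cell≤tableWeight : ∀ w T i j → w (lookup (T i) j) ≤ tableWeight w T
  cell≤tableWeight w T i j =
    ≤-trans (term≤sum (λ j' → w (lookup (T i) j')) j) (term≤sum (λ i' → vecWeight w (T i')) i)

  tableWeight-zero : ∀ w T → (∀ i j → w (lookup (T i) j) ≡ 0) → tableWeight w T ≡ 0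
  tableWeight-zero w T zero = sum-zero _ (λ i → sum-zero _ (zero i))

  hits : K → Fin m → Fin b → List (Fin k) → ℕ
  hits z a c [] = 0
  hits z a c (l ∷ ls) = (if does (a ≟F h₁ z) ∧ does (c ≟F g l z) then 1 else 0) + hits z a c ls

  contrib : K → Fin m → Fin b → ℕ
  contrib z a c = hits z a c (allFin k)

  cbbfInsert-counter : ∀ y C a c → cbbfInsert y C a c ≡ contrib y a c + C a c
  cbbfInsert-counter y C a c = go (allFin k)
    where
    go : ∀ ls → foldr (λ l C' → bump suc (h₁ y) (g l y) C') C ls a c ≡ hits y a c ls + C a c
    go [] = refl
    go (l ∷ ls) with does (a ≟F h₁ y) ∧ does (c ≟F g l y)
    ... | true = cong suc (go ls)
    ... | false = go ls

  cbbfRemove-counter : ∀ y C a c → cbbfRemove y C a c ≡ C a c ∸ contrib y a c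
  cbbfRemove-counter y C a c = go (allFin k)
    where
    go : ∀ ls → foldr (λ l C' → bump (λ n → n ∸ 1) (h₁ y) (g l y) C') C ls a c ≡ C a c ∸ hits y a c ls
    go [] = refl
    go (l ∷ ls) with does (a ≟F h₁ y) ∧ does (c ≟F g l y)
    ... | true = trans (cong (_∸ 1) (go ls))
                   (trans (∸-+-assoc (C a c) (hits y a c ls) 1) (cong (C a c ∸_) (+-comm (hits y a c ls) 1)))
    ... | false = go ls

  contrib-elsewhere : ∀ z {a} c → a ≢ h₁ z → contrib z a c ≡ 0
  contrib-elsewhere z {a} c a≢ = go (allFin k)
    where
    go : ∀ ls → hits z a c ls ≡ 0
    go [] = refl
    go (l ∷ ls) with a ≟F h₁ z
    ... | yes a≡ = ⊥-elim (a≢ a≡)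
    ... | no _ = go ls

  contrib-own : ∀ z l → 1 ≤ contrib z (h₁ z) (g l z)
  contrib-own z l = go (allFin k) (∈-allFin l)
    where
    go : ∀ ls → l ∈ ls → 1 ≤ hits z (h₁ z) (g l z) ls
    go (_ ∷ ls) (here refl) with h₁ z ≟F h₁ z | g l z ≟F g l z
    ... | yes _ | yes _ = s≤s z≤n
    ... | no ≢block | _ = ⊥-elim (≢block refl)
    ... | yes _ | no ≢bit = ⊥-elim (≢bit refl)
    go (_ ∷ ls) (there l∈ls) = ≤-trans (go ls l∈ls) (m≤n+m _ _)

  -- The load of a cell on counter (a , c): elements stored via h₂ are in the CBBF.
  load : Fin m → Fin b → Cell → ℕ
  load a c (just (entry z _ second)) = contrib z a c
  load a c _ = 0

  demand : Table → Fin m → Fin b → ℕ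
  demand T a c = tableWeight (load a c) T

  Exact : Table → Counters → Set
  Exact T C = ∀ a c → C a c ≡ demand T a c

  removeDisplaced-counter : ∀ cell C a c → removeDisplaced cell C a c ≡ C a c ∸ load a c cell
  removeDisplaced-counter nothing C a c = refl
  removeDisplaced-counter (just (entry z _ first)) C a c = refl
  removeDisplaced-counter (just (entry z _ second)) C a c = cbbfRemove-counter z C a c

  removeDisplaced-≤ : ∀ cell C a c → removeDisplaced cell C a c ≤ C a c
  removeDisplaced-≤ cell C a c = ≤-trans (≤-reflexive (removeDisplaced-counter cell C a c)) (m∸n≤m (C a c) (load a c cell))

  exact-setCell : ∀ {T C} i j new → Exact T C
    → ∀ a c → load a c new + removeDisplaced (lookup (T i) j) C a c ≡ demand (setCell i j new T) a c
  exact-setCell {T} {C} i j new exact a c = begin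
    load a c new + removeDisplaced old C a c  ≡⟨ cong (load a c new +_) (removeDisplaced-counter old C a c) ⟩
    load a c new + (C a c ∸ load a c old)     ≡⟨ cong (λ n → load a c new + (n ∸ load a c old)) (exact a c) ⟩
    load a c new + (demand T a c ∸ load a c old)
      ≡⟨ exchange-∸ (tableWeight-setCell (load a c) i j new T) (cell≤tableWeight (load a c) T i j) ⟨
    demand (setCell i j new T) a c  ∎
    where
    open ≡-Reasoning
    old : Cell
    old = lookup (T i) j

  bit-mono : ∀ {n n'} → n ≤ n' → not (isZero n) ≡ true → not (isZero n') ≡ true
  bit-mono (s≤s _) _ = refl

  positive-mono : ∀ {C C'} z → (∀ a c → C a c ≤ C' a c) → positive C z ≡ true → positive C' z ≡ true
  positive-mono z C≤C' = all-mono (allFin k) (λ l → bit-mono (C≤C' (h₁ z) (g l z)))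

  negative-antitone : ∀ {C C'} z → (∀ a c → C a c ≤ C' a c) → positive C' z ≡ false → positive C z ≡ false
  negative-antitone {C} z C≤C' neg with positive C z in pos
  ... | false = refl
  ... | true = trans (sym (positive-mono z C≤C' pos)) neg

  positive-block : ∀ {C C'} z → (∀ c → C (h₁ z) c ≡ C' (h₁ z) c) → positive C z ≡ positive C' z
  positive-block z same = all-cong (allFin k) (λ l → cong (λ n → not (isZero n)) (same (g l z)))

  exact-positive : ∀ {T C} → Exact T C → ∀ {i j z v}
                 → lookup (T i) j ≡ just (entry z v second) → positive C z ≡ true
  exact-positive {T} {C} exact {i} {j} {z} stored = all-true _ (allFin k) (λ l → bit-mono (loaded l) refl)
    where
    loaded : ∀ l → 1 ≤ C (h₁ z) (g l z)
    loaded l = ≤-trans (contrib-own z l) (≤-trans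
      (subst (λ cell → load (h₁ z) (g l z) cell ≤ demand T (h₁ z) (g l z)) stored
             (cell≤tableWeight (load (h₁ z) (g l z)) T i j))
      (≤-reflexive (sym (exact (h₁ z) (g l z)))))

  PlacedAt : Fin m → Cell → Set
  PlacedAt i nothing = ⊤
  PlacedAt i (just e) = hashOf (via e) (key e) ≡ i

  Negative : Counters → Cell → Set
  Negative C (just (entry z _ first)) = positive C z ≡ false
  Negative C _ = ⊤

  negative-weaken : ∀ {C C'} → (∀ a c → C' a c ≤ C a c) → ∀ cell → Negative C cell → Negative C' cell
  negative-weaken C'≤C (just (entry z _ first)) neg = negative-antitone z C'≤C neg
  negative-weaken C'≤C (just (entry z _ second)) _ = tt
  negative-weaken C'≤C nothing _ = tt

  itemOcc : K → Item → ℕ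
  itemOcc x (y , _) = if does (y ≟ x) then 1 else 0

  stashOcc : K → List Item → ℕ
  stashOcc x [] = 0
  stashOcc x (item ∷ l) = itemOcc x item + stashOcc x l

  cellOcc : K → Cell → ℕ
  cellOcc x nothing = 0
  cellOcc x (just e) = itemOcc x (key e , val e)

  occ : State → K → ℕ
  occ s x = stashOcc x (stash s) + tableWeight (cellOcc x) (table s)

  itemOcc-self : ∀ x v → itemOcc x (x , v) ≡ 1
  itemOcc-self x v = if-yes (x ≟ x) refl

  stashOcc-++ : ∀ x l₁ l₂ → stashOcc x (l₁ ++ l₂) ≡ stashOcc x l₁ + stashOcc x l₂
  stashOcc-++ x [] l₂ = refl
  stashOcc-++ x (item ∷ l₁) l₂ = trans (cong (itemOcc x item +_) (stashOcc-++ x l₁ l₂)) (sym (+-assoc (itemOcc x item) (stashOcc x l₁) (stashOcc x l₂)))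

  stashOcc-displaced : ∀ x cell → stashOcc x (displacedItems cell) ≡ cellOcc x cell
  stashOcc-displaced x nothing = refl
  stashOcc-displaced x (just e) = +-identityʳ _

  stashOcc-filter : ∀ x (p : Item → Bool) l → stashOcc x (filterᵇ p l) ≤ stashOcc x l
  stashOcc-filter x p [] = ≤-refl
  stashOcc-filter x p (item ∷ l) with p item
  ... | true = +-monoʳ-≤ (itemOcc x item) (stashOcc-filter x p l)
  ... | false = ≤-trans (stashOcc-filter x p l) (m≤n+m _ _)

  member-occ : ∀ x v l → (x , v) ∈ l → 1 ≤ stashOcc x l
  member-occ x v (_ ∷ l) (here refl) = ≤-trans (≤-reflexive (sym (itemOcc-self x v))) (m≤m+n _ _)
  member-occ x v (_ ∷ l) (there mem) = ≤-trans (member-occ x v l mem) (m≤n+m _ _)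

  stashOcc-absent : ∀ x l → (∀ v → ¬ (x , v) ∈ l) → stashOcc x l ≡ 0
  stashOcc-absent x [] _ = refl
  stashOcc-absent x ((y , w) ∷ l) absent with y ≟ x
  ... | yes refl = ⊥-elim (absent w (here refl))
  ... | no _ = stashOcc-absent x l (λ v mem → absent v (there mem))

  stored-occ : ∀ {x v h} T i j → lookup (T i) j ≡ just (entry x v h) → 1 ≤ tableWeight (cellOcc x) T
  stored-occ {x} {v} T i j stored = ≤-trans
    (≤-reflexive (sym (trans (cong (cellOcc x) stored) (itemOcc-self x v))))
    (cell≤tableWeight (cellOcc x) T i j)

  findStash-complete : ∀ x v l → stashOcc x l ≤ 1 → (x , v) ∈ l → findStash x l ≡ just v
  findStash-complete x v (_ ∷ l) _ (here refl) = if-yes (x ≟ x) refl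
  findStash-complete x v ((y , w) ∷ l) once (there mem) with y ≟ x
  ... | no _ = findStash-complete x v l once mem
  ... | yes refl = ⊥-elim (not-twice (s≤s z≤n) (member-occ x v l mem) once)

  findStash-occ : ∀ x v l → findStash x l ≡ just v → 1 ≤ stashOcc x l
  findStash-occ x v ((y , w) ∷ l) found with y ≟ x
  ... | yes refl = s≤s z≤n
  ... | no _ = findStash-occ x v l found

  findIn-complete : ∀ {n} x v h (B : Vec Cell n) j → vecWeight (cellOcc x) B ≤ 1
                  → lookup B j ≡ just (entry x v h) → findIn x B ≡ just v
  findIn-complete x v h (nothing ∷ᵥ B) fzero once ()
  findIn-complete x v h (nothing ∷ᵥ B) (fsuc j) once stored = findIn-complete x v h B j once stored
  findIn-complete x v h (just _ ∷ᵥ B) fzero once refl = if-yes (x ≟ x) refl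
  findIn-complete x v h (just e ∷ᵥ B) (fsuc j) once stored with key e ≟ x
  ... | no _ = findIn-complete x v h B j once stored
  ... | yes refl = ⊥-elim (not-twice (s≤s z≤n) again once)
    where
    again : 1 ≤ vecWeight (cellOcc x) B
    again = ≤-trans (≤-reflexive (sym (trans (cong (cellOcc x) stored) (itemOcc-self x v))))
                    (term≤sum (λ j' → cellOcc x (lookup B j')) j)

  findCell-sound : ∀ {n} x (B : Vec Cell n) j e → findCell x B ≡ just (j , e) → lookup B j ≡ just e
  findCell-sound x (nothing ∷ᵥ B) j e found with findCell x B in found′
  findCell-sound x (nothing ∷ᵥ B) _ _ refl | just (j , e) = findCell-sound x B j e found′
  findCell-sound x (just e₀ ∷ᵥ B) j e found with does (key e₀ ≟ x) | findCell x B in found′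
  findCell-sound x (just e₀ ∷ᵥ B) _ _ refl | true | _ = refl
  findCell-sound x (just e₀ ∷ᵥ B) _ _ refl | false | just (j , e) = findCell-sound x B j e found′

  evict-occ : ∀ {n} x p (B : Vec Cell n)
    → vecWeight (cellOcc x) (evict p B) + stashOcc x (cellItems (filterᵇ p (toList B))) ≡ vecWeight (cellOcc x) B
  evict-occ x p Vec.[] = refl
  evict-occ x p (cell ∷ᵥ B) with p cell
  evict-occ x p (nothing ∷ᵥ B) | true = evict-occ x p B
  evict-occ x p (just e ∷ᵥ B) | true =
    trans (swap (vecWeight (cellOcc x) (evict p B)) (cellOcc x (just e)) _)
          (cong (cellOcc x (just e) +_) (evict-occ x p B))
    where
    swap : ∀ r o f → r + (o + f) ≡ o + (r + f)
    swap = solve-∀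
  ... | false = trans (+-assoc (cellOcc x cell) _ _) (cong (cellOcc x cell +_) (evict-occ x p B))

  evict-weight : ∀ {n} (w : Cell → ℕ) p (B : Vec Cell n) → (∀ cell → p cell ≡ true → w cell ≡ w nothing)
               → vecWeight w (evict p B) ≡ vecWeight w B
  evict-weight w p Vec.[] _ = refl
  evict-weight w p (cell ∷ᵥ B) unweighted with p cell in evicted
  ... | true = cong₂ _+_ (sym (unweighted cell evicted)) (evict-weight w p B unweighted)
  ... | false = cong (w cell +_) (evict-weight w p B unweighted)

  Placed : Table → Set
  Placed = AllCells PlacedAt

  FirstNegative : Table → Counters → Set
  FirstNegative T C = AllCells (λ _ → Negative C) T

  record Invariant (s : State) : Set where
    field
      placed   : Placed (table s)
      negative : FirstNegative (table s) (cbbf s)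
      exact    : Exact (table s) (cbbf s)
      unique   : ∀ x → occ s x ≤ 1

  module Eviction (y : K) (T : Table) (C : Counters) (st : List Item) where
    C' : Counters
    C' = cbbfInsert y C
    T' : Table
    T' = table (finishSecond y T C st)

    kept-negative : ∀ cell → Negative C cell → Negative C' (if becomesPos C C' cell then nothing else cell)
    kept-negative nothing _ = tt
    kept-negative (just (entry z v second)) _ = tt
    kept-negative (just (entry z v first)) neg rewrite neg with positive C' z in pos
    ... | true = tt
    ... | false = pos

    -- an h₁-element outside bucket h₁(y) lies in another block, untouched by y
    distant-negative : ∀ {i} cell → PlacedAt i cell → i ≢ h₁ y → Negative C cell → Negative C' cell
    distant-negative nothing _ _ _ = tt
    distant-negative (just (entry z v second)) _ _ _ = tt
    distant-negative (just (entry z v first)) refl h₁z≢ neg =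
      trans (positive-block {C'} {C} z (λ c → trans (cbbfInsert-counter y C (h₁ z) c)
                                          (cong (_+ C (h₁ z) c) (contrib-elsewhere y c h₁z≢))))
            neg

    placed′ : Placed T → Placed T'
    placed′ placed = AllCells-evict {PlacedAt} (h₁ y) (becomesPos C C') placed (λ _ → tt)

    negative′ : Placed T → FirstNegative T C → FirstNegative T' C'
    negative′ placed negative i j with i ≟F h₁ y
    ... | yes refl rewrite lookup-map j (λ cell → if becomesPos C C' cell then nothing else cell) (T i) =
      kept-negative (lookup (T i) j) (negative i j)
    ... | no i≢ = distant-negative (lookup (T i) j) (placed i j) i≢ (negative i j)

    -- only h₁-elements are evicted, and they carry no load
    demand′ : ∀ a c → demand T' a c ≡ demand T a c
    demand′ a c = +-cancelʳ-≡ (vecWeight (load a c) B) _ _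
      (trans (tableWeight-setBucket (load a c) (h₁ y) (evict (becomesPos C C') B) T)
             (cong (demand T a c +_) (evict-weight (load a c) _ B unloaded)))
      where
      B : Bucket
      B = T (h₁ y)
      unloaded : ∀ cell → becomesPos C C' cell ≡ true → load a c cell ≡ load a c nothing
      unloaded (just (entry z v first)) _ = refl

    -- evicted elements move to the stash
    occ′ : ∀ x → occ (finishSecond y T C st) x ≡ stashOcc x st + tableWeight (cellOcc x) T
    occ′ x = begin
      stashOcc x (F ++ st) + W′        ≡⟨ cong (_+ W′) (stashOcc-++ x F st) ⟩
      stashOcc x F + stashOcc x st + W′ ≡⟨ swap (stashOcc x F) (stashOcc x st) W′ ⟩
      stashOcc x st + (W′ + stashOcc x F) ≡⟨ cong (stashOcc x st +_) evicted ⟩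
      stashOcc x st + tableWeight (cellOcc x) T ∎
      where
      open ≡-Reasoning
      B : Bucket
      B = T (h₁ y)
      F : List Item
      F = cellItems (filterᵇ (becomesPos C C') (toList B))
      W′ : ℕ
      W′ = tableWeight (cellOcc x) T'
      evicted : W′ + stashOcc x F ≡ tableWeight (cellOcc x) T
      evicted = trans (exchange-trans {u = vecWeight (cellOcc x) B}
                  (tableWeight-setBucket (cellOcc x) (h₁ y) (evict (becomesPos C C') B) T)
                  (trans (evict-occ x (becomesPos C C') B) (sym (+-identityʳ _))))
                (+-identityʳ _)
      swap : ∀ f s w → f + s + w ≡ s + (w + f)
      swap = solve-∀

  finishSecond-invariant : ∀ y T C st → Placed T → FirstNegative T C
    → (∀ a c → contrib y a c + C a c ≡ demand T a c)
    → (∀ x → stashOcc x st + tableWeight (cellOcc x) T ≤ 1)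
    → Invariant (finishSecond y T C st)
  finishSecond-invariant y T C st placed negative exact unique = record
    { placed   = placed′ placed
    ; negative = negative′ placed negative
    ; exact    = λ a c → trans (cbbfInsert-counter y C a c) (trans (exact a c) (sym (demand′ a c)))
    ; unique   = λ x → ≤-trans (≤-reflexive (occ′ x)) (unique x)
    }
    where open Eviction y T C st

  chosenFirst-negative : ∀ {s y} → ChooseHash s y first → positive (cbbf s) y ≡ false
  chosenFirst-negative (free₁ neg _) = neg
  chosenFirst-negative (avoid neg _ _) = neg
  chosenFirst-negative (random neg _ _ _ _) = neg

  module Placement (s : State) (pre post : List Item) (y : K) (w : V) (h : Hash) (j : Fin 4)
                   (split : stash s ≡ pre ++ (y , w) ∷ post) (inv : Invariant s) where
    open Invariant inv
    i : Fin m
    i = hashOf h y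
    old new : Cell
    old = lookup (table s i) j
    new = just (entry y w h)
    T₁ : Table
    T₁ = setCell i j new (table s)
    C₁ : Counters
    C₁ = removeDisplaced old (cbbf s)
    st₁ : List Item
    st₁ = displacedItems old ++ (pre ++ post)

    placed₁ : Placed T₁
    placed₁ = AllCells-setCell {PlacedAt} i j new placed refl

    negative₁ : Negative C₁ new → FirstNegative T₁ C₁
    negative₁ = AllCells-setCell {λ _ → Negative C₁} i j new
      (λ i' j' → negative-weaken (removeDisplaced-≤ old (cbbf s)) _ (negative i' j'))

    exact₁ : ∀ a c → load a c new + C₁ a c ≡ demand T₁ a c
    exact₁ = exact-setCell i j new exact

    occ₁ : ∀ x → stashOcc x st₁ + tableWeight (cellOcc x) T₁ ≡ occ s x
    occ₁ x = begin
      stashOcc x st₁ + W₁                          ≡⟨ cong (_+ W₁) moved ⟩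
      cellOcc x old + (P + Q) + W₁                 ≡⟨ swap (cellOcc x old) (P + Q) W₁ ⟩
      P + Q + (W₁ + cellOcc x old)                 ≡⟨ cong (P + Q +_) (tableWeight-setCell (cellOcc x) i j new (table s)) ⟩
      P + Q + (W + itemOcc x (y , w))              ≡⟨ reinsert P Q W (itemOcc x (y , w)) ⟩
      P + (itemOcc x (y , w) + Q) + W              ≡⟨ cong (_+ W) (trans (cong (stashOcc x) split) (stashOcc-++ x pre _)) ⟨
      stashOcc x (stash s) + W                     ∎
      where
      open ≡-Reasoning
      P Q W W₁ : ℕ
      P = stashOcc x pre
      Q = stashOcc x post
      W = tableWeight (cellOcc x) (table s)
      W₁ = tableWeight (cellOcc x) T₁
      moved : stashOcc x st₁ ≡ cellOcc x old + (P + Q)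
      moved = trans (stashOcc-++ x (displacedItems old) (pre ++ post))
                    (cong₂ _+_ (stashOcc-displaced x old) (stashOcc-++ x pre post))
      swap : ∀ o pq w₁ → o + pq + w₁ ≡ pq + (w₁ + o)
      swap = solve-∀
      reinsert : ∀ p q w₀ n → p + q + (w₀ + n) ≡ p + (n + q) + w₀
      reinsert = solve-∀

  place-invariant : ∀ {s} pre post y w h j → stash s ≡ pre ++ (y , w) ∷ post → ChooseHash s y h
                  → Invariant s → Invariant (place s (pre ++ post) y w h j)
  place-invariant {s} pre post y w first j split choice inv = record
    { placed   = placed₁
    ; negative = negative₁ (negative-antitone y (removeDisplaced-≤ old (cbbf s)) (chosenFirst-negative choice))
    ; exact    = exact₁
    ; unique   = λ x → ≤-trans (≤-reflexive (occ₁ x)) (Invariant.unique inv x)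
    }
    where open Placement s pre post y w first j split inv
  place-invariant {s} pre post y w second j split _ inv =
    finishSecond-invariant y T₁ C₁ st₁ placed₁ (negative₁ tt) exact₁
      (λ x → ≤-trans (≤-reflexive (occ₁ x)) (Invariant.unique inv x))
    where open Placement s pre post y w second j split inv

  steps-invariant : ∀ {n s s'} → StepsUpTo n s s' → Invariant s → Invariant s'
  steps-invariant stop inv = inv
  steps-invariant (next (step pre post y w split h choice j _) rest) inv =
    steps-invariant rest (place-invariant pre post y w h j split choice inv)

  occ-absent : ∀ s x → ¬ Present s x → occ s x ≡ 0
  occ-absent s x absent = cong₂ _+_
    (stashOcc-absent x (stash s) (λ v mem → absent (v , inj₁ mem)))
    (tableWeight-zero (cellOcc x) (table s) noCell)
    where
    noCell : ∀ i j → cellOcc x (lookup (table s i) j) ≡ 0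
    noCell i j with lookup (table s i) j in stored
    ... | nothing = refl
    ... | just (entry y w h) with y ≟ x
    ...   | yes refl = ⊥-elim (absent (w , inj₂ (i , j , h , stored)))
    ...   | no _ = refl

  push-invariant : ∀ s x v → ¬ Present s x → Invariant s → Invariant (record s { stash = (x , v) ∷ stash s })
  push-invariant s x v absent inv = record
    { placed = placed ; negative = negative ; exact = exact ; unique = unique′ }
    where
    open Invariant inv
    unique′ : ∀ x' → itemOcc x' (x , v) + stashOcc x' (stash s) + tableWeight (cellOcc x') (table s) ≤ 1
    unique′ x' with x ≟ x'
    ... | yes refl = ≤-reflexive (cong suc (occ-absent s x absent))
    ... | no _ = unique x'

  delete-invariant : ∀ x i s → Invariant s → Invariant (deleteAt x i s)
  delete-invariant x i s inv with findCell x (table s i) in found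
  ... | nothing = inv
  ... | just (j , e) = record
    { placed   = AllCells-setCell {PlacedAt} i j nothing placed tt
    ; negative = AllCells-setCell {λ _ → Negative (removeDisplaced (just e) (cbbf s))} i j nothing
                   (λ i' j' → negative-weaken (removeDisplaced-≤ (just e) (cbbf s)) _ (negative i' j')) tt
    ; exact    = λ a c → subst (λ cell → removeDisplaced cell (cbbf s) a c ≡ demand T′ a c)
                               (findCell-sound x (table s i) j e found)
                               (exact-setCell i j nothing exact a c)
    ; unique   = λ x' → ≤-trans (+-monoʳ-≤ (stashOcc x' (stash s)) (fewer x')) (unique x')
    }
    where
    open Invariant inv
    T′ : Table
    T′ = setCell i j nothing (table s)
    fewer : ∀ x' → tableWeight (cellOcc x') T′ ≤ tableWeight (cellOcc x') (table s)
    fewer x' = ≤-trans (m≤m+n _ (cellOcc x' (lookup (table s i) j)))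
                       (≤-reflexive (trans (tableWeight-setCell (cellOcc x') i j nothing (table s)) (+-identityʳ _)))

  remove-invariant : ∀ x s → Invariant s → Invariant (remove x s)
  remove-invariant x s inv with findStash x (stash s)
  ... | just _ = record
    { placed = placed ; negative = negative ; exact = exact
    ; unique = λ x' → ≤-trans (+-monoˡ-≤ _ (stashOcc-filter x' _ (stash s))) (unique x') }
    where open Invariant inv
  ... | nothing = delete-invariant x (searchBucket s x) s inv

  initial-invariant : Invariant initial
  initial-invariant = record
    { placed   = λ i j → subst (PlacedAt i) (sym (empty j)) tt
    ; negative = λ i j → subst (Negative _) (sym (empty j)) tt
    ; exact    = λ a c → sym (tableWeight-zero (load a c) (table initial) (λ _ j → cong (load a c) (empty j)))
    ; unique   = λ x → ≤-trans (≤-reflexive (tableWeight-zero (cellOcc x) (table initial) (λ _ j → cong (cellOcc x) (empty j)))) z≤n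
    }
    where
    empty : ∀ j → lookup (Vec.replicate 4 nothing) j ≡ nothing
    empty j = lookup-replicate j nothing

  reachable-invariant : ∀ {s D} → Reachable s D → Invariant s
  reachable-invariant init = initial-invariant
  reachable-invariant (op r (ins x v absent steps)) =
    steps-invariant steps (push-invariant _ x v absent (reachable-invariant r))
  reachable-invariant (op r (del x)) = remove-invariant x _ (reachable-invariant r)

  -- The bucket chosen by a search is the one holding the element: an element
  -- stored via h₁ is negative and one stored via h₂ is positive.
  searchBucket-correct : ∀ {s} → Invariant s → ∀ {x v h} i j
    → lookup (table s i) j ≡ just (entry x v h) → searchBucket s x ≡ i
  searchBucket-correct {s} inv {x} {v} {first} i j stored =
    trans (cong (λ pos → if pos then h₂ x else h₁ x) (subst (Negative (cbbf s)) stored (negative i j)))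
          (subst (PlacedAt i) stored (placed i j))
    where open Invariant inv
  searchBucket-correct {s} inv {x} {v} {second} i j stored =
    trans (cong (λ pos → if pos then h₂ x else h₁ x) (exact-positive {table s} exact {i} {j} stored))
          (subst (PlacedAt i) stored (placed i j))
    where open Invariant inv

  -- Under the invariant a search reads at most one bucket and finds every stored key:
  -- a key in the stash is in no bucket, and a key in a bucket is in the bucket read.
  search-correct : ∀ s → Invariant s → ∀ x
    → proj₂ (search s x) ≤ 1 × (∀ v → Stored s x v → proj₁ (search s x) ≡ just v)
  search-correct s inv x with findStash x (stash s) in found
  ... | just v′ = z≤n , fromStash
    where
    open Invariant inv
    fromStash : ∀ v → Stored s x v → just v′ ≡ just v
    fromStash v (inj₁ mem) =
      trans (sym found) (findStash-complete x v (stash s) (≤-trans (m≤m+n _ _) (unique x)) mem)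
    fromStash v (inj₂ (i , j , h , stored)) =
      ⊥-elim (not-twice (findStash-occ x v′ (stash s) found) (stored-occ (table s) i j stored) (unique x))
  ... | nothing = s≤s z≤n , fromTable
    where
    open Invariant inv
    fromTable : ∀ v → Stored s x v → findIn x (table s (searchBucket s x)) ≡ just v
    fromTable v (inj₁ mem) with trans (sym (findStash-complete x v (stash s) (≤-trans (m≤m+n _ _) (unique x)) mem)) found
    ... | ()
    fromTable v (inj₂ (i , j , h , stored)) =
      subst (λ i' → findIn x (table s i') ≡ just v) (sym (searchBucket-correct inv i j stored))
        (findIn-complete x v h (table s i) j onceInBucket stored)
      where
      onceInBucket : vecWeight (cellOcc x) (table s i) ≤ 1
      onceInBucket = ≤-trans (term≤sum (λ i' → vecWeight (cellOcc x) (table s i')) i)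
                             (≤-trans (m≤n+m _ (stashOcc x (stash s))) (unique x))

theorem1 : ∀ {K V : Set} (_≟_ : DecidableEquality K) (m b k t : ℕ)
           (h₁ h₂ : K → Fin m) (g : Fin k → K → Fin b)
           → let open EMOMA {K} {V} _≟_ m b k t h₁ h₂ g in
           (s : State) (D : List Item) → Reachable s D
           → (∀ x v → (x , v) ∈ D → Stored s x v)
           → (x : K)
           → proj₂ (search s x) ≤ 1 × (∀ v → Stored s x v → proj₁ (search s x) ≡ just v)
theorem1 {K} {V} _≟_ m b k t h₁ h₂ g s _ reachable _ x =
  search-correct s (reachable-invariant reachable) x
  where open Correctness {K} {V} _≟_ m b k t h₁ h₂ g
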